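{- Let $G$ be a bipartite graph with parts $V_1,V_2$, $|V_i|=n_i$ for $i\in[2]$, and $e(G)=\alpha n_1n_2$. If $p,q\in\mathbb{N}$ satisfy $\alpha n_1>4(p+q)$ and $\alpha^2 n_2>256q$, then $G$ contains a $TH^{(3)}$ for every graph $H$ with $p$ vertices and $q$ edges.
   Context: $TH^{(3)}$ is the graph obtained from $H$ by replacing each edge $uv$ by a $u,v$-path of length exactly $4$, these paths pairwise internally vertex-disjoint and internally disjoint from $V(H)$. -}

module Defs where

open import Data.Nat using (ℕ; zero; suc; _+_; _*_; _<_)
open import Data.Bool using (Bool; true; false; T; if_then_else_)
open import Data.Fin using (Fin) renaming (_<_ to _<ᶠ_)
open import Data.Fin using () renaming (zero to f0; suc to fs)
open import Data.List using (List; map; allFin)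
open import Data.Nat.ListAction using (sum)
open import Data.Sum using (_⊎_; inj₁; inj₂)
open import Data.Product using (_×_; _,_; proj₁; proj₂; Σ; ∃; ∃-syntax)
open import Data.Empty using (⊥)
open import Relation.Binary.PropositionalEquality using (_≡_)
open import Relation.Nullary using (¬_)

-- A bipartite graph G with parts V₁ = Fin n₁ and V₂ = Fin n₂:
-- E a b = true iff a ∈ V₁ and b ∈ V₂ are adjacent.
BipGraph : ℕ → ℕ → Set
BipGraph n₁ n₂ = Fin n₁ → Fin n₂ → Bool

Vtx : ℕ → ℕ → Set
Vtx n₁ n₂ = Fin n₁ ⊎ Fin n₂

Adj : ∀ {n₁ n₂} → BipGraph n₁ n₂ → Vtx n₁ n₂ → Vtx n₁ n₂ → Set
Adj E (inj₁ a) (inj₂ b) = T (E a b)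
Adj E (inj₂ b) (inj₁ a) = T (E a b)
Adj E (inj₁ _) (inj₁ _) = ⊥
Adj E (inj₂ _) (inj₂ _) = ⊥

edgeCount : ∀ {n₁ n₂} → BipGraph n₁ n₂ → ℕ
edgeCount {n₁} {n₂} E =
  sum (map (λ a → sum (map (λ b → if E a b then 1 else 0) (allFin n₂))) (allFin n₁))

record SimpleGraph (p q : ℕ) : Set where
  field
    edge      : Fin q → Fin p × Fin p
    ordered   : ∀ k → proj₁ (edge k) <ᶠ proj₂ (edge k)
    distinct  : ∀ k l → edge k ≡ edge l → k ≡ l

-- G contains a TH^(3) (a copy of H with every edge replaced by a path of
-- length exactly 4, paths internally vertex-disjoint and internally disjoint
-- from the branch vertices), as a (not necessarily induced) subgraph.
-- branch x  : image of vertex x of H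
-- inner k j : the j-th internal vertex (j = 0,1,2) of the path replacing edge k
record TH3In {n₁ n₂ p q : ℕ} (E : BipGraph n₁ n₂) (H : SimpleGraph p q) : Set where
  open SimpleGraph H
  field
    branch        : Fin p → Vtx n₁ n₂
    inner         : Fin q → Fin 3 → Vtx n₁ n₂
    branch-inj    : ∀ x y → branch x ≡ branch y → x ≡ y
    inner-inj     : ∀ k l i j → inner k i ≡ inner l j → (k ≡ l) × (i ≡ j)
    inner≢branch  : ∀ k i x → ¬ (inner k i ≡ branch x)
    path₀ : ∀ k → Adj E (branch (proj₁ (edge k))) (inner k f0)
    path₁ : ∀ k → Adj E (inner k f0) (inner k (fs f0))
    path₂ : ∀ k → Adj E (inner k (fs f0)) (inner k (fs (fs f0)))
    path₃ : ∀ k → Adj E (inner k (fs (fs f0))) (branch (proj₂ (edge k)))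

{-# OPTIONS --safe #-}
module Submission where

-- Call a, a′ ∈ V₁ a sparse pair if they have fewer than 2q common neighbours.  Double counting
-- bounds the number of triples (b, a, a′) with a, a′ ∈ N(b) sparse by 2q·n₁², and Cauchy–Schwarz
-- gives n₂·Σ_b d(b)² ≥ e²; the two hypotheses then yield b ∈ V₂ with
-- d(b)² > 2(p+q)·d(b) + 64·#{sparse pairs in N(b)}.  Discarding from N(b) the vertices with at
-- least d(b)/8 sparse partners leaves a set A in which every vertex is sparse with at most
-- (|A| − p − q)/2 others.  The subdivision is then found greedily: p branch vertices in A; for
-- each edge uv of H a new midpoint m ∈ A forming non-sparse pairs with u and v; and new vertices
-- of V₂ adjacent to u and m, resp. to m and v, which exist because each such pair has 2q common
-- neighbours while at most 2q − 1 vertices of V₂ are used by the other paths.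

open import Defs
open import Data.Nat using (ℕ; zero; suc; _+_; _*_; _<_; _≤_; z≤n; s≤s; z<s; _<ᵇ_; _<?_)
open import Data.Nat.Properties hiding (_≟_)
open import Data.Nat.Tactic.RingSolver using (solve-∀)
open import Algebra.Properties.Semiring.Sum +-*-semiring
  using (sum; sum-syntax; sum-cong-≗; sum-replicate-zero; ∑-distrib-+; ∑-comm;
         *-distribˡ-sum; *-distribʳ-sum)
import Data.Nat.ListAction as ListAction
import Data.List as List
open import Data.List.Properties using (map-tabulate)
open import Data.Bool using (Bool; true; false; T; T?; if_then_else_; _∧_; not)
open import Data.Bool.Properties using (T-∧; T-not-≡)
open import Data.Unit using (tt)
open import Data.Fin using (Fin; zero; suc; _≟_)
open import Data.Fin.Properties using (any?)
open import Data.Fin.Patterns using (0F; 1F; 2F)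
open import Data.Vec.Functional using ([]; _∷_)
open import Data.Sum using (inj₁; inj₂)
open import Data.Sum.Properties using (inj₁-injective; inj₂-injective)
open import Data.Product using (_×_; _,_; proj₁; proj₂; ∃; ∃-syntax)
open import Data.Empty using (⊥-elim)
open import Function using (_∘_; id)
open import Function.Bundles using (module Equivalence)
open import Relation.Binary.PropositionalEquality
open import Relation.Nullary using (¬_; yes; no; does; contradiction)
open import Relation.Nullary.Decidable using (dec-true)

open Equivalence using (to; from)

χ : Bool → ℕ
χ b = if b then 1 else 0

∑-mono-≤ : ∀ {n} {f g : Fin n → ℕ} → (∀ i → f i ≤ g i) → sum f ≤ sum g
∑-mono-≤ {zero}  f≤g = z≤n
∑-mono-≤ {suc n} f≤g = +-mono-≤ (f≤g zero) (∑-mono-≤ (f≤g ∘ suc))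

∑-const : ∀ n c → ∑[ i < n ] c ≡ n * c
∑-const zero    c = refl
∑-const (suc n) c = cong (c +_) (∑-const n c)

sum-map-allFin : ∀ n (f : Fin n → ℕ) → ListAction.sum (List.map f (List.allFin n)) ≡ sum f
sum-map-allFin n f = trans (cong ListAction.sum (map-tabulate id f)) (sum-tabulate n f)
  where
  sum-tabulate : ∀ n (f : Fin n → ℕ) → ListAction.sum (List.tabulate f) ≡ sum f
  sum-tabulate zero    f = refl
  sum-tabulate (suc n) f = cong (f zero +_) (sum-tabulate n (f ∘ suc))

m≤n⇒2*[m*n]≤m*m+n*n : ∀ {m n} → m ≤ n → 2 * (m * n) ≤ m * m + n * n
m≤n⇒2*[m*n]≤m*m+n*n {m} m≤n with d , refl ← m≤n⇒∃[o]m+o≡n m≤n =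
  subst (2 * (m * (m + d)) ≤_) (gap m d) (m≤m+n _ (d * d))
  where
  gap : ∀ m d → 2 * (m * (m + d)) + d * d ≡ m * m + (m + d) * (m + d)
  gap = solve-∀

2*[m*n]≤m*m+n*n : ∀ m n → 2 * (m * n) ≤ m * m + n * n
2*[m*n]≤m*m+n*n m n with ≤-total m n
... | inj₁ m≤n = m≤n⇒2*[m*n]≤m*m+n*n m≤n
... | inj₂ n≤m = subst₂ _≤_ (cong (2 *_) (*-comm n m)) (+-comm (n * n) (m * m))
                        (m≤n⇒2*[m*n]≤m*m+n*n n≤m)

∑-square-≤ : ∀ n (f : Fin n → ℕ) → sum f * sum f ≤ n * ∑[ i < n ] (f i * f i)
∑-square-≤ zero    f = z≤n
∑-square-≤ (suc n) f = begin
  (x + R) * (x + R)                  ≡⟨ expand x R ⟩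
  x * x + 2 * (x * R) + R * R        ≤⟨ +-mono-≤ (+-monoʳ-≤ (x * x) cross) (∑-square-≤ n g) ⟩
  x * x + (n * (x * x) + Q) + n * Q  ≡⟨ regroup (x * x) Q n ⟩
  suc n * (x * x + Q)                ∎
  where
  open ≤-Reasoning
  x = f zero
  g = f ∘ suc
  R = sum g
  Q = ∑[ i < n ] (g i * g i)
  expand : ∀ x R → (x + R) * (x + R) ≡ x * x + 2 * (x * R) + R * R
  expand = solve-∀
  regroup : ∀ a b n → a + (n * a + b) + n * b ≡ (1 + n) * (a + b)
  regroup = solve-∀
  cross : 2 * (x * R) ≤ n * (x * x) + Q
  cross = begin
    2 * (x * R)                     ≡⟨ cong (2 *_) (*-distribˡ-sum x g) ⟩
    2 * ∑[ i < n ] (x * g i)        ≡⟨ *-distribˡ-sum 2 (λ i → x * g i) ⟩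
    ∑[ i < n ] (2 * (x * g i))      ≤⟨ ∑-mono-≤ (λ i → 2*[m*n]≤m*m+n*n x (g i)) ⟩
    ∑[ i < n ] (x * x + g i * g i)  ≡⟨ ∑-distrib-+ (λ _ → x * x) (λ i → g i * g i) ⟩
    ∑[ i < n ] (x * x) + Q          ≡⟨ cong (_+ Q) (∑-const n (x * x)) ⟩
    n * (x * x) + Q                 ∎

count : ∀ {n} → (Fin n → Bool) → ℕ
count {n} P = ∑[ x < n ] χ (P x)

count-split : ∀ {n} (P Q : Fin n → Bool) →
              count P ≡ count (λ x → P x ∧ Q x) + count (λ x → P x ∧ not (Q x))
count-split P Q = trans (sum-cong-≗ (λ x → χ-split (P x) (Q x)))
                        (∑-distrib-+ (λ x → χ (P x ∧ Q x)) (λ x → χ (P x ∧ not (Q x))))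
  where
  χ-split : ∀ a b → χ a ≡ χ (a ∧ b) + χ (a ∧ not b)
  χ-split false b     = refl
  χ-split true  false = refl
  χ-split true  true  = refl

count-≤-split₂ : ∀ {n} (P Q R : Fin n → Bool) →
                 count P ≤ count (λ x → P x ∧ Q x) +
                           (count (λ x → P x ∧ R x) + count (λ x → (P x ∧ not (Q x)) ∧ not (R x)))
count-≤-split₂ P Q R = ≤-trans (∑-mono-≤ (λ x → χ-split₂ (P x) (Q x) (R x))) (≤-reflexive distribute)
  where
  distribute : ∑[ x < _ ] (χ (P x ∧ Q x) + (χ (P x ∧ R x) + χ ((P x ∧ not (Q x)) ∧ not (R x))))
               ≡ count (λ x → P x ∧ Q x) +
                 (count (λ x → P x ∧ R x) + count (λ x → (P x ∧ not (Q x)) ∧ not (R x)))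
  distribute = trans (∑-distrib-+ (λ x → χ (P x ∧ Q x)) _)
                     (cong (count (λ x → P x ∧ Q x) +_)
                           (∑-distrib-+ (λ x → χ (P x ∧ R x)) (λ x → χ ((P x ∧ not (Q x)) ∧ not (R x)))))
  χ-split₂ : ∀ p q r → χ p ≤ χ (p ∧ q) + (χ (p ∧ r) + χ ((p ∧ not q) ∧ not r))
  χ-split₂ false _     _     = z≤n
  χ-split₂ true  true  _     = s≤s z≤n
  χ-split₂ true  false true  = s≤s z≤n
  χ-split₂ true  false false = s≤s z≤n

count-mono : ∀ {n} {P Q : Fin n → Bool} → (∀ x → T (P x) → T (Q x)) → count P ≤ count Q
count-mono P⇒Q = ∑-mono-≤ (λ x → χ-mono (P⇒Q x))
  where
  χ-mono : ∀ {a b} → (T a → T b) → χ a ≤ χ b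
  χ-mono {false}         _   = z≤n
  χ-mono {true}  {true}  _   = ≤-refl
  χ-mono {true}  {false} a⇒b = ⊥-elim (a⇒b tt)

count-singleton : ∀ {n} (y : Fin n) → count (λ x → does (x ≟ y)) ≡ 1
count-singleton {suc n} zero    = cong suc (sum-replicate-zero n)
count-singleton         (suc y) = count-singleton y

count-pos : ∀ {n} (P : Fin n → Bool) → 0 < count P → ∃[ x ] T (P x)
count-pos {n} P 0<count with any? (λ x → T? (P x))
... | yes ∃P = ∃P
... | no  ∄P = contradiction 0<count (≤⇒≯ (≤-trans (count-mono (λ x Px → ∄P (x , Px)))
                                                   (≤-reflexive (sum-replicate-zero n))))

count-remove : ∀ {n} (P : Fin n → Bool) y → count P ≤ 1 + count (λ x → P x ∧ not (does (x ≟ y)))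
count-remove P y = begin
  count P                                   ≡⟨ count-split P (λ x → does (x ≟ y)) ⟩
  count (λ x → P x ∧ does (x ≟ y)) + count P∖y  ≤⟨ +-monoˡ-≤ (count P∖y) at-most-y ⟩
  1 + count P∖y                             ∎
  where
  open ≤-Reasoning
  P∖y = λ x → P x ∧ not (does (x ≟ y))
  at-most-y : count (λ x → P x ∧ does (x ≟ y)) ≤ 1
  at-most-y = ≤-trans (count-mono {Q = λ x → does (x ≟ y)} (λ x → proj₂ ∘ to T-∧))
                      (≤-reflexive (count-singleton y))

∃-outside : ∀ {n f} (P : Fin n → Bool) (F : Fin f → Fin n) → f < count P →
            ∃[ x ] T (P x) × (∀ j → x ≢ F j)
∃-outside {f = zero} P F 0<count with x , Px ← count-pos P 0<count = x , Px , λ ()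
∃-outside {f = suc f} P F 1+f<count
  with x , P′x , x∉F′ ← ∃-outside (λ x → P x ∧ not (does (x ≟ F zero))) (F ∘ suc)
                                  (+-cancelˡ-< 1 f _ (<-≤-trans 1+f<count (count-remove P (F zero))))
  with Px , x≢F₀ ← to T-∧ P′x
  = x , Px , λ { zero    x≡F₀ → subst (T ∘ not) (dec-true (x ≟ F zero) x≡F₀) x≢F₀
                ; (suc j)      → x∉F′ j }

record Representatives {n k f : ℕ} (C : Fin k → Fin n → Bool) (F : Fin f → Fin n) : Set where
  field
    rep           : Fin k → Fin n
    rep∈          : ∀ i → T (C i (rep i))
    rep∉          : ∀ i j → rep i ≢ F j
    rep-injective : ∀ i i′ → rep i ≡ rep i′ → i ≡ i′

∷-representatives : ∀ {n k f} {C : Fin (suc k) → Fin n → Bool} {F : Fin f → Fin n} {x : Fin n} →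
                    T (C zero x) → (∀ j → x ≢ F j) → Representatives (C ∘ suc) (x ∷ F) →
                    Representatives C F
∷-representatives {x = x} x∈C₀ x∉F R = record
  { rep           = x ∷ rep
  ; rep∈          = λ { zero → x∈C₀ ; (suc i) → rep∈ i }
  ; rep∉          = λ { zero → x∉F ; (suc i) j → rep∉ i (suc j) }
  ; rep-injective = λ { zero    zero     _  → refl
                      ; zero    (suc i′) eq → ⊥-elim (rep∉ i′ zero (sym eq))
                      ; (suc i) zero     eq → ⊥-elim (rep∉ i zero eq)
                      ; (suc i) (suc i′) eq → cong suc (rep-injective i i′ eq) }
  }
  where open Representatives R

greedy-representatives : ∀ {n} k f (C : Fin k → Fin n → Bool) (F : Fin f → Fin n) →
                         (∀ i → f + k ≤ count (C i)) → Representatives C F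
greedy-representatives zero f C F _ =
  record { rep = λ () ; rep∈ = λ () ; rep∉ = λ () ; rep-injective = λ () }
greedy-representatives (suc k) f C F large
  with x , x∈C₀ , x∉F ← ∃-outside (C zero) F (<-≤-trans (m<m+n f z<s) (large zero))
  = ∷-representatives x∈C₀ x∉F (greedy-representatives k (suc f) (C ∘ suc) (x ∷ F) large′)
  where
  large′ : ∀ i → suc f + k ≤ count (C (suc i))
  large′ i = ≤-trans (≤-reflexive (sym (+-suc f k))) (large (suc i))

module _ {n₁ n₂ : ℕ} (G : BipGraph n₁ n₂) where

  deg : Fin n₂ → ℕ
  deg b = count (λ a → G a b)

  codeg : Fin n₁ → Fin n₁ → ℕ
  codeg a a′ = count (λ b → G a b ∧ G a′ b)

  sparse : ℕ → Fin n₁ → Fin n₁ → Bool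
  sparse t a a′ = codeg a a′ <ᵇ t

  ¬sparse⇒t≤codeg : ∀ {t a a′} → T (not (sparse t a a′)) → t ≤ codeg a a′
  ¬sparse⇒t≤codeg ¬sparse = ≮⇒≥ (λ codeg<t → subst T (to T-not-≡ ¬sparse) (<⇒<ᵇ codeg<t))

  edgeCount≡∑deg : edgeCount G ≡ ∑[ b < n₂ ] deg b
  edgeCount≡∑deg = trans (sum-map-allFin n₁ _)
                  (trans (sum-cong-≗ (λ a → sum-map-allFin n₂ (λ b → χ (G a b))))
                         (∑-comm (λ a b → χ (G a b))))

  sparsePartners : ℕ → (Fin n₁ → Bool) → Fin n₁ → ℕ
  sparsePartners t A a = count (λ a′ → A a′ ∧ sparse t a a′)

  Robust : ℕ → ℕ → (Fin n₁ → Bool) → Set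
  Robust t s A = ∀ a → T (A a) → 2 * sparsePartners t A a + s ≤ count A

  robust⇒TH3In : ∀ {p q} (H : SimpleGraph p q) (A : Fin n₁ → Bool) →
                 p ≤ count A → Robust (2 * q) (p + q) A → TH3In G H
  robust⇒TH3In {p} {q} H A p≤|A| robust = record
    { branch       = inj₁ ∘ rep branches
    ; inner        = inner
    ; branch-inj   = λ x y → rep-injective branches x y ∘ inj₁-injective
    ; inner-inj    = inner-inj
    ; inner≢branch = inner≢branch
    ; path₀        = λ k → proj₁ (to T-∧ (rep∈ firsts k))
    ; path₁        = λ k → proj₂ (to T-∧ (rep∈ firsts k))
    ; path₂        = λ k → proj₂ (to T-∧ (rep∈ seconds k))
    ; path₃        = λ k → proj₁ (to T-∧ (rep∈ seconds k))
    }
    where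
    open SimpleGraph H
    open Representatives

    branches : Representatives (λ (_ : Fin p) → A) []
    branches = greedy-representatives p 0 (λ _ → A) [] (λ _ → p≤|A|)

    u v : Fin q → Fin n₁
    u k = rep branches (proj₁ (edge k))
    v k = rep branches (proj₂ (edge k))

    midpoint-candidate : Fin q → Fin n₁ → Bool
    midpoint-candidate k a = (A a ∧ not (sparse (2 * q) (u k) a)) ∧ not (sparse (2 * q) (v k) a)

    many-candidates : ∀ k → p + q ≤ count (midpoint-candidate k)
    many-candidates k =
      leftover (sparsePartners (2 * q) A (u k)) (sparsePartners (2 * q) A (v k))
               (count-≤-split₂ A (sparse (2 * q) (u k)) (sparse (2 * q) (v k)))
               (robust (u k) (rep∈ branches (proj₁ (edge k))))
               (robust (v k) (rep∈ branches (proj₂ (edge k))))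
      where
      open ≤-Reasoning
      leftover : ∀ {a c s} x y → a ≤ x + (y + c) → 2 * x + s ≤ a → 2 * y + s ≤ a → s ≤ c
      leftover {a} {c} {s} x y a≤ x-small y-small =
        *-cancelˡ-≤ 2 (+-cancelˡ-≤ (2 * (x + y)) (2 * s) (2 * c) (begin
          2 * (x + y) + 2 * s          ≡⟨ split x y s ⟩
          (2 * x + s) + (2 * y + s)    ≤⟨ +-mono-≤ x-small y-small ⟩
          a + a                        ≤⟨ +-mono-≤ a≤ a≤ ⟩
          x + (y + c) + (x + (y + c))  ≡⟨ merge x y c ⟩
          2 * (x + y) + 2 * c          ∎))
        where
        split : ∀ x y s → 2 * (x + y) + 2 * s ≡ (2 * x + s) + (2 * y + s)
        split = solve-∀
        merge : ∀ x y c → x + (y + c) + (x + (y + c)) ≡ 2 * (x + y) + 2 * c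
        merge = solve-∀

    midpoints : Representatives midpoint-candidate (rep branches)
    midpoints = greedy-representatives q p midpoint-candidate (rep branches) many-candidates

    mid : Fin q → Fin n₁
    mid = rep midpoints

    candidate-dense : ∀ {k a} → T (midpoint-candidate k a) →
                      T (not (sparse (2 * q) (u k) a)) × T (not (sparse (2 * q) (v k) a))
    candidate-dense c with A∖u , ¬sparse-v ← to T-∧ c = proj₂ (to T-∧ A∖u) , ¬sparse-v

    mid-dense-u : ∀ k → 2 * q ≤ codeg (u k) (mid k)
    mid-dense-u k = ¬sparse⇒t≤codeg (proj₁ (candidate-dense (rep∈ midpoints k)))

    mid-dense-v : ∀ k → 2 * q ≤ codeg (v k) (mid k)
    mid-dense-v k = ¬sparse⇒t≤codeg (proj₂ (candidate-dense (rep∈ midpoints k)))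

    firsts : Representatives (λ k b → G (u k) b ∧ G (mid k) b) []
    firsts = greedy-representatives q 0 _ [] (λ k → ≤-trans (m≤m+n q (q + 0)) (mid-dense-u k))

    seconds : Representatives (λ k b → G (v k) b ∧ G (mid k) b) (rep firsts)
    seconds = greedy-representatives q q _ (rep firsts)
                (λ k → ≤-trans (≤-reflexive (cong (q +_) (sym (+-identityʳ q)))) (mid-dense-v k))

    inner : Fin q → Fin 3 → Vtx n₁ n₂
    inner k 0F = inj₂ (rep firsts k)
    inner k 1F = inj₁ (mid k)
    inner k 2F = inj₂ (rep seconds k)

    inner-inj : ∀ k l i j → inner k i ≡ inner l j → (k ≡ l) × (i ≡ j)
    inner-inj k l 0F 0F eq = rep-injective firsts k l (inj₂-injective eq) , refl
    inner-inj k l 1F 1F eq = rep-injective midpoints k l (inj₁-injective eq) , refl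
    inner-inj k l 2F 2F eq = rep-injective seconds k l (inj₂-injective eq) , refl
    inner-inj k l 0F 2F eq = ⊥-elim (rep∉ seconds l k (sym (inj₂-injective eq)))
    inner-inj k l 2F 0F eq = ⊥-elim (rep∉ seconds k l (inj₂-injective eq))
    inner-inj k l 0F 1F ()
    inner-inj k l 1F 0F ()
    inner-inj k l 1F 2F ()
    inner-inj k l 2F 1F ()

    inner≢branch : ∀ k i x → inner k i ≢ inj₁ (rep branches x)
    inner≢branch k 0F x ()
    inner≢branch k 1F x eq = rep∉ midpoints k x (inj₁-injective eq)
    inner≢branch k 2F x ()

  module _ (t : ℕ) where

    sparseDeg : Fin n₂ → Fin n₁ → ℕ
    sparseDeg b a = count (λ a′ → sparse t a a′ ∧ G a′ b)

    sparsePairsFrom : Fin n₂ → Fin n₁ → ℕ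
    sparsePairsFrom b a = ∑[ a′ < n₁ ] χ (sparse t a a′ ∧ (G a b ∧ G a′ b))

    sparsePairs : Fin n₂ → ℕ
    sparsePairs b = ∑[ a < n₁ ] sparsePairsFrom b a

    ∑-sparsePairs : ∑[ b < n₂ ] sparsePairs b ≤ n₁ * (n₁ * t)
    ∑-sparsePairs = begin
      ∑[ b < n₂ ] ∑[ a < n₁ ] ∑[ a′ < n₁ ] χ (sparse t a a′ ∧ (G a b ∧ G a′ b))
        ≡⟨ ∑-comm (λ b a → ∑[ a′ < n₁ ] χ (sparse t a a′ ∧ (G a b ∧ G a′ b))) ⟩
      ∑[ a < n₁ ] ∑[ b < n₂ ] ∑[ a′ < n₁ ] χ (sparse t a a′ ∧ (G a b ∧ G a′ b))
        ≡⟨ sum-cong-≗ (λ a → ∑-comm (λ b a′ → χ (sparse t a a′ ∧ (G a b ∧ G a′ b)))) ⟩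
      ∑[ a < n₁ ] ∑[ a′ < n₁ ] ∑[ b < n₂ ] χ (sparse t a a′ ∧ (G a b ∧ G a′ b))
        ≤⟨ ∑-mono-≤ (λ a → ∑-mono-≤ (sparse-codeg≤t a)) ⟩
      ∑[ a < n₁ ] ∑[ a′ < n₁ ] t
        ≡⟨ trans (sum-cong-≗ {n₁} (λ _ → ∑-const n₁ t)) (∑-const n₁ (n₁ * t)) ⟩
      n₁ * (n₁ * t) ∎
      where
      open ≤-Reasoning
      sparse-codeg≤t : ∀ a a′ → ∑[ b < n₂ ] χ (sparse t a a′ ∧ (G a b ∧ G a′ b)) ≤ t
      sparse-codeg≤t a a′ with sparse t a a′ in sparse-aa′
      ... | true  = <⇒≤ (<ᵇ⇒< (codeg a a′) t (subst T (sym sparse-aa′) tt))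
      ... | false = ≤-trans (≤-reflexive (sum-replicate-zero n₂)) z≤n

    Dense : ℕ → Fin n₂ → Set
    Dense s b = 2 * s * deg b + 64 * sparsePairs b < deg b * deg b

    ∄dense⇒e²≤ : ∀ s → (∀ b → ¬ Dense s b) →
                 let e = ∑[ b < n₂ ] deg b in e * e ≤ n₂ * (2 * s * e + 64 * (n₁ * (n₁ * t)))
    ∄dense⇒e²≤ s ∄dense = begin
      e * e                                                  ≤⟨ ∑-square-≤ n₂ deg ⟩
      n₂ * ∑[ b < n₂ ] (deg b * deg b)                       ≤⟨ *-monoʳ-≤ n₂ (∑-mono-≤ (≮⇒≥ ∘ ∄dense)) ⟩
      n₂ * ∑[ b < n₂ ] (2 * s * deg b + 64 * sparsePairs b)  ≡⟨ cong (n₂ *_) split ⟩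
      n₂ * (2 * s * e + 64 * ∑[ b < n₂ ] sparsePairs b)      ≤⟨ *-monoʳ-≤ n₂ (+-monoʳ-≤ (2 * s * e)
                                                                  (*-monoʳ-≤ 64 ∑-sparsePairs)) ⟩
      n₂ * (2 * s * e + 64 * (n₁ * (n₁ * t)))                ∎
      where
      open ≤-Reasoning
      e = ∑[ b < n₂ ] deg b
      split : ∑[ b < n₂ ] (2 * s * deg b + 64 * sparsePairs b)
              ≡ 2 * s * e + 64 * ∑[ b < n₂ ] sparsePairs b
      split = trans (∑-distrib-+ (λ b → 2 * s * deg b) (λ b → 64 * sparsePairs b))
                    (sym (cong₂ _+_ (*-distribˡ-sum (2 * s) deg) (*-distribˡ-sum 64 sparsePairs)))

    ∃-dense : ∀ s → 4 * s * n₂ < edgeCount G → 128 * t * (n₁ * n₁ * n₂) < edgeCount G * edgeCount G →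
              ∃ (Dense s)
    ∃-dense s h₁ h₂ with any? (λ b → 2 * s * deg b + 64 * sparsePairs b <? deg b * deg b)
    ... | yes dense = dense
    ... | no  ∄dense = contradiction (subst (λ e → 128 * t * (n₁ * n₁ * n₂) < e * e) edgeCount≡∑deg h₂)
                                     (≤⇒≯ (e²≤ (subst (4 * s * n₂ <_) edgeCount≡∑deg h₁)
                                               (∄dense⇒e²≤ s (λ b d → ∄dense (b , d)))))
      where
      open ≤-Reasoning
      e²≤ : ∀ {e} → 4 * s * n₂ < e → e * e ≤ n₂ * (2 * s * e + 64 * (n₁ * (n₁ * t))) →
            e * e ≤ 128 * t * (n₁ * n₁ * n₂)
      e²≤ {e} 4sn₂<e e²≤X = +-cancelˡ-≤ (e * e) _ _ (begin
        e * e + e * e                                ≤⟨ +-mono-≤ e²≤X e²≤X ⟩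
        X + X                                        ≡⟨ expand e s t n₁ n₂ ⟩
        4 * s * n₂ * e + 128 * t * (n₁ * n₁ * n₂)    ≤⟨ +-monoˡ-≤ _ (*-monoˡ-≤ e (<⇒≤ 4sn₂<e)) ⟩
        e * e + 128 * t * (n₁ * n₁ * n₂)             ∎)
        where
        X = n₂ * (2 * s * e + 64 * (n₁ * (n₁ * t)))
        expand : ∀ e s t n₁ n₂ → n₂ * (2 * s * e + 64 * (n₁ * (n₁ * t)))
                                 + n₂ * (2 * s * e + 64 * (n₁ * (n₁ * t)))
                                 ≡ 4 * s * n₂ * e + 128 * t * (n₁ * n₁ * n₂)
        expand = solve-∀

    module _ {s : ℕ} {b : Fin n₂} (dense : Dense s b) where

      light : Fin n₁ → Bool
      light a = 8 * sparseDeg b a <ᵇ deg b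

      core : Fin n₁ → Bool
      core a = G a b ∧ light a

      few-heavy : 8 * count (λ a → G a b ∧ not (light a)) + 2 * s < deg b
      few-heavy = *-cancelʳ-< m (8 * k + 2 * s) m (begin-strict
        (8 * k + 2 * s) * m                   ≡⟨ distribute m k s ⟩
        2 * s * m + 8 * (k * m)               ≤⟨ +-monoʳ-≤ (2 * s * m) (*-monoʳ-≤ 8 k*m≤) ⟩
        2 * s * m + 8 * (8 * sparsePairs b)   ≡⟨ cong (2 * s * m +_) (sym (*-assoc 8 8 (sparsePairs b))) ⟩
        2 * s * m + 64 * sparsePairs b        <⟨ dense ⟩
        m * m                                 ∎)
        where
        open ≤-Reasoning
        m = deg b
        k = count (λ a → G a b ∧ not (light a))
        distribute : ∀ m k s → (8 * k + 2 * s) * m ≡ 2 * s * m + 8 * (k * m)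
        distribute = solve-∀
        heavy-weight : ∀ a → χ (G a b ∧ not (light a)) * m ≤ 8 * sparsePairsFrom b a
        heavy-weight a with G a b | light a in light-a
        ... | false | _     = z≤n
        ... | true  | true  = z≤n
        ... | true  | false = ≤-trans (≤-reflexive (*-identityˡ m))
                                      (≮⇒≥ (λ lt → subst T light-a (<⇒<ᵇ lt)))
        k*m≤ : k * m ≤ 8 * sparsePairs b
        k*m≤ = begin
          k * m                               ≡⟨ *-distribʳ-sum m (λ a → χ (G a b ∧ not (light a))) ⟩
          ∑[ a < n₁ ] (χ (G a b ∧ not (light a)) * m)  ≤⟨ ∑-mono-≤ heavy-weight ⟩
          ∑[ a < n₁ ] (8 * sparsePairsFrom b a)  ≡⟨ sym (*-distribˡ-sum 8 (sparsePairsFrom b)) ⟩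
          8 * sparsePairs b                   ∎

      core-bound : ∀ x → 8 * x < deg b → 2 * x + s ≤ count core
      core-bound x 8x<m = bound {x = x} (count-split (λ a → G a b) light) few-heavy 8x<m
        where
        open ≤-Reasoning
        bound : ∀ {m c k x} → m ≡ c + k → 8 * k + 2 * s < m → 8 * x < m → 2 * x + s ≤ c
        bound {m} {c} {k} {x} m≡c+k heavy-small x-small =
          <⇒≤ (+-cancelʳ-< k (2 * x + s) c (*-cancelˡ-< 8 _ _ (begin-strict
            8 * (2 * x + s + k)                ≤⟨ m≤m+n _ (24 * k) ⟩
            8 * (2 * x + s + k) + 24 * k       ≡⟨ regroup x s k ⟩
            2 * (8 * x) + 4 * (8 * k + 2 * s)  <⟨ +-mono-< (*-monoʳ-< 2 x-small) (*-monoʳ-< 4 heavy-small) ⟩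
            2 * m + 4 * m                      ≡⟨ *-distribʳ-+ m 2 4 ⟨
            6 * m                              ≤⟨ *-monoˡ-≤ m (m≤m+n 6 2) ⟩
            8 * m                              ≡⟨ cong (8 *_) m≡c+k ⟩
            8 * (c + k)                        ∎)))
          where
          regroup : ∀ x s k → 8 * (2 * x + s + k) + 24 * k ≡ 2 * (8 * x) + 4 * (8 * k + 2 * s)
          regroup = solve-∀

      core-large : s ≤ count core
      core-large = core-bound 0 (≤-<-trans z≤n few-heavy)

      core-robust : Robust t s core
      core-robust a a∈core =
        core-bound (sparsePartners t core a)
                   (≤-<-trans (*-monoʳ-≤ 8 (count-mono core∧sparse⇒sparse∧G))
                              (<ᵇ⇒< _ _ (proj₂ (to (T-∧ {G a b}) a∈core))))
        where
        core∧sparse⇒sparse∧G : ∀ a′ → T (core a′ ∧ sparse t a a′) → T (sparse t a a′ ∧ G a′ b)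
        core∧sparse⇒sparse∧G a′ h with a′∈core , sp ← to (T-∧ {core a′}) h =
          from T-∧ (sp , proj₁ (to (T-∧ {G a′ b}) a′∈core))

lemma4p1 : (n₁ n₂ : ℕ) → 1 ≤ n₁ → 1 ≤ n₂ → (G : BipGraph n₁ n₂) → (p q : ℕ)
    → 4 * (p + q) * n₂ < edgeCount G
    → 256 * q * (n₁ * n₁ * n₂) < edgeCount G * edgeCount G
    → (H : SimpleGraph p q) → TH3In G H
lemma4p1 n₁ n₂ _ _ G p q h₁ h₂ H =
  robust⇒TH3In G H (core G t {p + q} dense) (≤-trans (m≤m+n p q) (core-large G t dense))
                   (core-robust G t dense)
  where
  t : ℕ
  t = 2 * q
  h₂′ : 128 * t * (n₁ * n₁ * n₂) < edgeCount G * edgeCount G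
  h₂′ = subst (λ c → c * (n₁ * n₁ * n₂) < edgeCount G * edgeCount G) (*-assoc 128 2 q) h₂
  dense : Dense G t (p + q) (proj₁ (∃-dense G t (p + q) h₁ h₂′))
  dense = proj₂ (∃-dense G t (p + q) h₁ h₂′)
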